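{- Let $a\ge 1$, and let $(c,d),(e,f)\in\mathcal{B}$ with $d$ and $f$ odd, $d\ne f$, and $\max\{c,c+d,e,e+f\}<a$. Then $U=\{(a,0),(c,d),(e,f)\}$ is unavoidable in $\mathcal{B}$.
   Context: The bicyclic inverse semigroup is $\mathcal{B}=\{(a,b)\in\mathbb{Z}\times\mathbb{Z}\mid a\ge 0,\ a+b\ge 0\}$ with multiplication $(a,b)(c,d)=(\max\{c+d,a\}-d,\ b+d)$. A subset $U\subseteq\mathcal{B}$ is avoidable if $\mathcal{B}$ can be partitioned into two sets $A$ and $B$ such that no element of $U$ is a product $st$ of two distinct elements $s\ne t$ both in $A$ or both in $B$; otherwise $U$ is unavoidable. -}

module Defs where

open import Data.Integer using (ℤ; +_; _+_; _-_; _*_; _≤_; _<_; _⊔_)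
open import Data.Product using (_×_; _,_; Σ; ∃; proj₁)
open import Data.Bool using (Bool)
open import Data.Empty using (⊥)
open import Relation.Nullary using (¬_)
open import Relation.Binary.PropositionalEquality using (_≡_; _≢_)

Oddℤ : ℤ → Set
Oddℤ d = ∃ λ (k : ℤ) → d ≡ + 2 * k + + 1

InB : ℤ × ℤ → Set
InB (a , b) = (+ 0 ≤ a) × (+ 0 ≤ a + b)

𝓑 : Set
𝓑 = Σ (ℤ × ℤ) InB

_·_ : ℤ × ℤ → ℤ × ℤ → ℤ × ℤ
(a , b) · (c , d) = (((c + d) ⊔ a) - d , b + d)

-- U is avoidable if there is a 2-colouring (partition into A = colour true,
-- B = colour false) with no element of U a product of two distinct
-- same-coloured elements.
Avoidable : (ℤ × ℤ → Set) → Set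
Avoidable U = ∃ λ (col : 𝓑 → Bool) →
  ∀ (s t : 𝓑) → proj₁ s ≢ proj₁ t → col s ≡ col t →
    ¬ U (proj₁ s · proj₁ t)

Unavoidable : (ℤ × ℤ → Set) → Set
Unavoidable U = ¬ Avoidable U

Three : ℤ × ℤ → ℤ × ℤ → ℤ × ℤ → ℤ × ℤ → Set
Three x y z w = (w ≡ x) ⊎' ((w ≡ y) ⊎' (w ≡ z))
  where
  open import Data.Sum using () renaming (_⊎_ to _⊎'_)

module Submission where

open import Defs
open import Data.Integer using (ℤ; +_; _+_; _≤_; _<_; _⊔_)
open import Data.Product using (_×_; _,_)
open import Relation.Binary.PropositionalEquality using (_≢_)

open import Data.Integer using (-_; _-_; _*_; 0ℤ; 1ℤ; +≤+)
open import Data.Integer.Properties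
  using (+-mono-≤; +-monoˡ-≤; i≤j⇒0≤j-i; 0≤i-j⇒j≤i; i<j⇒suc[i]≤j; i≤j⇒i⊔j≡j; i≥j⇒i⊔j≡i;
         i≤i⊔j; i≤j⊔i; ⊔-lub; neg-mono-<; neg-involutive; +-inverseˡ; +-inverseʳ; +-identityʳ; +-assoc;
         ≤-trans; ≤-<-trans; <⇒≤; <-cmp; _≤?_; ≰⇒>)
open import Data.Integer.Tactic.RingSolver using (solve)
open import Data.Nat using (z≤n)
open import Data.List using (_∷_; [])
open import Data.Product using (∃; proj₁; proj₂)
open import Data.Sum using (_⊎_; inj₁; inj₂)
open import Data.Bool using (Bool; not)
open import Data.Bool.Properties using (¬-not; not-involutive)
open import Relation.Nullary using (¬_; yes; no)
open import Data.Empty using (⊥; ⊥-elim)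
open import Relation.Binary.Definitions using (tri<; tri≈; tri>)
open import Relation.Binary.PropositionalEquality
  using (_≡_; refl; sym; trans; cong; cong₂; subst; module ≡-Reasoning)

-- Call s ≠ t in 𝓑 U-adjacent when st ∈ U or ts ∈ U.  A partition
-- avoiding U is a proper 2-colouring of this graph, so U is unavoidable as soon
-- as the graph contains a 5-cycle.  Writing f = d + 2g (d, f odd, so g ≠ 0; by
-- the symmetry (c,d) ↔ (e,f) we may take g > 0), such a cycle is
--     (a,g) — (a,-g) — (p,g) — (q,d+g) — (r,-g) — (a,g),
-- where the three edges through (a,±g) multiply to (a,0) whenever p ≤ a - g and
-- r ≤ a + g, while (p,g)—(q,d+g) multiplies to (e,f) and (q,d+g)—(r,-g) to (c,d)
-- for a choice of p, q, r depending on whether g ≤ c and whether e + d + g ≥ 0.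
-- The file first computes products in 𝓑 when one factor dominates, then shows
-- that a 5-cycle in the adjacency graph forces unavoidability, records the
-- parity facts, builds the cycle in each of the three cases, and finally derives
-- the theorem (reducing g < 0 to g > 0 by swapping (c,d) and (e,f)).

-- Linear inequalities are proved by certificates: y - x is exhibited, via a
-- ring identity, as a sum of quantities known to be nonnegative.

NonNeg : ℤ → Set
NonNeg t = 0ℤ ≤ t

infixl 6 _⊕_
_⊕_ : ∀ {s t} → NonNeg s → NonNeg t → NonNeg (s + t)
_⊕_ = +-mono-≤

one : NonNeg 1ℤ
one = +≤+ z≤n

slack : ∀ {x y} → x ≤ y → NonNeg (y - x)
slack = i≤j⇒0≤j-i

slack< : ∀ {x y} → x < y → NonNeg (y - (1ℤ + x))
slack< x<y = i≤j⇒0≤j-i (i<j⇒suc[i]≤j x<y)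

-- (The conclusion is written 0ℤ ≤ t rather than NonNeg t so that t is fixed by
-- the expected type before the ring solver inspects the identity.)
nonneg-by : ∀ {s t} → NonNeg s → s ≡ t → 0ℤ ≤ t
nonneg-by s≥0 eq = subst NonNeg eq s≥0

certified : ∀ {s x y} → NonNeg s → s ≡ y - x → x ≤ y
certified s≥0 eq = 0≤i-j⇒j≤i (nonneg-by s≥0 eq)

·-rightDominant : ∀ {x y z w} → x ≤ z + w → (x , y) · (z , w) ≡ (z , y + w)
·-rightDominant {x} {y} {z} {w} x≤z+w =
  cong (_, y + w) (trans (cong (_- w) (i≥j⇒i⊔j≡i x≤z+w)) (solve (z ∷ w ∷ [])))

·-leftDominant : ∀ {x y z w} → z + w ≤ x → (x , y) · (z , w) ≡ (x - w , y + w)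
·-leftDominant {x} {y} {z} {w} z+w≤x = cong (λ m → m - w , y + w) (i≤j⇒i⊔j≡j z+w≤x)

·-onAxis : ∀ {x y z w} → x ≤ z + w → y + w ≡ 0ℤ → (x , y) · (z , w) ≡ (z , 0ℤ)
·-onAxis {x} {y} {z} {w} x≤z+w cancel = trans (·-rightDominant {x} {y} x≤z+w) (cong (z ,_) cancel)

-- The smallest element of 𝓑 with second coordinate t: (max{0,-t}, t).
floor : ℤ → ℤ
floor t = 0ℤ ⊔ - t

floor∈B : ∀ t → InB (floor t , t)
floor∈B t =
  i≤i⊔j 0ℤ (- t) , nonneg-by (slack (i≤j⊔i 0ℤ (- t))) (cong (λ m → floor t + m) (neg-involutive t))

-- Odd 5-cycles are not 2-colourable: along a path b₁ ≠ b₂ ≠ b₃ of booleans the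
-- colour returns, so around a 5-cycle the first and last colours agree.
≢-twice : ∀ {b₁ b₂ b₃ : Bool} → b₁ ≢ b₂ → b₂ ≢ b₃ → b₁ ≡ b₃
≢-twice {b₃ = b₃} b₁≢b₂ b₂≢b₃ =
  trans (¬-not b₁≢b₂) (trans (cong not (¬-not b₂≢b₃)) (not-involutive b₃))

pentagon-not-2-colourable : ∀ {X : Set} (E : X → X → Set) (col : X → Bool) →
  (∀ {s t} → E s t → col s ≢ col t) →
  ∀ {x₁ x₂ x₃ x₄ x₅} → E x₁ x₂ → E x₂ x₃ → E x₃ x₄ → E x₄ x₅ → E x₅ x₁ → ⊥
pentagon-not-2-colourable E col proper e₁₂ e₂₃ e₃₄ e₄₅ e₅₁ =
  proper e₅₁ (sym (trans (≢-twice (proper e₁₂) (proper e₂₃)) (≢-twice (proper e₃₄) (proper e₄₅))))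

record Adjacent (U : ℤ × ℤ → Set) (s t : 𝓑) : Set where
  constructor adjacent
  field
    distinct  : proj₁ s ≢ proj₁ t
    product∈U : U (proj₁ s · proj₁ t) ⊎ U (proj₁ t · proj₁ s)

avoiding⇒proper : ∀ {U : ℤ × ℤ → Set} (col : 𝓑 → Bool) →
  (∀ (s t : 𝓑) → proj₁ s ≢ proj₁ t → col s ≡ col t → ¬ U (proj₁ s · proj₁ t)) →
  ∀ {s t} → Adjacent U s t → col s ≢ col t
avoiding⇒proper col avoids {s} {t} (adjacent s≢t (inj₁ st∈U)) same = avoids s t s≢t same st∈U
avoiding⇒proper col avoids {s} {t} (adjacent s≢t (inj₂ ts∈U)) same =
  avoids t s (λ eq → s≢t (sym eq)) (sym same) ts∈U

pentagon⇒unavoidable : ∀ {U x₁ x₂ x₃ x₄ x₅} →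
  Adjacent U x₁ x₂ → Adjacent U x₂ x₃ → Adjacent U x₃ x₄ → Adjacent U x₄ x₅ → Adjacent U x₅ x₁ →
  Unavoidable U
pentagon⇒unavoidable {U} e₁₂ e₂₃ e₃₄ e₄₅ e₅₁ (col , avoids) =
  pentagon-not-2-colourable (Adjacent U) col (avoiding⇒proper col avoids) e₁₂ e₂₃ e₃₄ e₄₅ e₅₁

adjacent→ : ∀ {U} {s t : 𝓑} {u} → proj₂ (proj₁ s) ≢ proj₂ (proj₁ t) → U u → proj₁ s · proj₁ t ≡ u →
  Adjacent U s t
adjacent→ {U} y≢w u∈U st≡u = adjacent (λ eq → y≢w (cong proj₂ eq)) (inj₁ (subst U (sym st≡u) u∈U))

adjacent← : ∀ {U} {s t : 𝓑} {u} → proj₂ (proj₁ s) ≢ proj₂ (proj₁ t) → U u → proj₁ t · proj₁ s ≡ u →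
  Adjacent U s t
adjacent← {U} y≢w u∈U ts≡u = adjacent (λ eq → y≢w (cong proj₂ eq)) (inj₂ (subst U (sym ts≡u) u∈U))

-- Parity.  An odd integer 2k + 1 is nonzero (it is ≥ 1 or ≤ -1 according to
-- the sign of k), and two odd integers differ by an even amount.
1≰0 : ¬ (1ℤ ≤ 0ℤ)
1≰0 (+≤+ ())

2k+1≢0 : ∀ k → + 2 * k + 1ℤ ≢ 0ℤ
2k+1≢0 k 2k+1≡0 with 0ℤ ≤? k
... | yes 0≤k = 1≰0 (certified (0≤k ⊕ 0≤k) (begin
  k + k                   ≡⟨ solve (k ∷ []) ⟩
  (+ 2 * k + 1ℤ) - 1ℤ     ≡⟨ cong (_- 1ℤ) 2k+1≡0 ⟩
  0ℤ - 1ℤ                 ∎))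
  where open ≡-Reasoning
... | no 0≰k = 1≰0 (certified (slack< k<0 ⊕ slack< k<0) (begin
  (0ℤ - (1ℤ + k)) + (0ℤ - (1ℤ + k))   ≡⟨ solve (k ∷ []) ⟩
  - (+ 2 * k + 1ℤ) - 1ℤ               ≡⟨ cong (λ m → - m - 1ℤ) 2k+1≡0 ⟩
  0ℤ - 1ℤ                             ∎))
  where
  open ≡-Reasoning
  k<0 : k < 0ℤ
  k<0 = ≰⇒> 0≰k

odd⇒≢0 : ∀ {d} → Oddℤ d → d ≢ 0ℤ
odd⇒≢0 (k , d≡2k+1) d≡0 = 2k+1≢0 k (trans (sym d≡2k+1) d≡0)

odd-difference : ∀ {d f} → Oddℤ d → Oddℤ f → ∃ λ g → f ≡ d + g + g
odd-difference {d} {f} (k , d≡2k+1) (l , f≡2l+1) = l - k , (begin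
  f                                   ≡⟨ f≡2l+1 ⟩
  + 2 * l + 1ℤ                        ≡⟨ solve (k ∷ l ∷ []) ⟩
  (+ 2 * k + 1ℤ) + (l - k) + (l - k)  ≡⟨ cong (λ m → m + (l - k) + (l - k)) (sym d≡2k+1) ⟩
  d + (l - k) + (l - k)               ∎)
  where open ≡-Reasoning

-- Throughout, f = d + g + g with g > 0; of the bounds on a only
-- c < a and e + f < a are needed (this is what makes the two roles of (c,d)
-- and (e,f) interchangeable in the theorem).
module FiveCycle (U : ℤ × ℤ → Set) {a c d e g : ℤ}
  (a∈U : U (a , 0ℤ)) (cd∈U : U (c , d)) (ef∈U : U (e , d + g + g))
  (0≤c : 0ℤ ≤ c) (0≤c+d : 0ℤ ≤ c + d) (0≤e : 0ℤ ≤ e) (0≤e+f : 0ℤ ≤ e + (d + g + g))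
  (c<a : c < a) (e+f<a : e + (d + g + g) < a)
  (0<g : 0ℤ < g) (d≢0 : d ≢ 0ℤ) (f≢0 : d + g + g ≢ 0ℤ) where

  0≤g : 0ℤ ≤ g
  0≤g = <⇒≤ 0<g

  0≤a : 0ℤ ≤ a
  0≤a = ≤-trans 0≤c (<⇒≤ c<a)

  g≢-g : g ≢ - g
  g≢-g g≡-g = 1≰0 (certified (slack< 0<g ⊕ slack< 0<-g ⊕ one) (solve (g ∷ [])))
    where
    0<-g : 0ℤ < - g
    0<-g = subst (0ℤ <_) g≡-g 0<g

  -g≢g : - g ≢ g
  -g≢g -g≡g = g≢-g (sym -g≡g)

  g≢d+g : g ≢ d + g
  g≢d+g g≡d+g = d≢0 (begin
    d              ≡⟨ solve (d ∷ g ∷ []) ⟩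
    (d + g) - g    ≡⟨ cong (_- g) (sym g≡d+g) ⟩
    g - g          ≡⟨ +-inverseʳ g ⟩
    0ℤ             ∎)
    where open ≡-Reasoning

  d+g≢-g : d + g ≢ - g
  d+g≢-g d+g≡-g = f≢0 (trans (cong (_+ g) d+g≡-g) (+-inverseˡ g))

  e∈B : InB (e , g)
  e∈B = 0≤e , 0≤e ⊕ 0≤g

  -- The cycle (a,g) — (a,-g) — (p,g) — (q,d+g) — (r,-g): the three edges at
  -- (a,±g) multiply to (a,0) as soon as p ≤ a - g and r ≤ a + g, so it only
  -- remains to close the cycle with the edges at (q,d+g).
  module Cycle {p q r : ℤ} (p∈B : InB (p , g)) (q∈B : InB (q , d + g)) (r∈B : InB (r , - g))
    (p≤a-g : p ≤ a - g) (r≤a+g : r ≤ a + g) where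

    X₁ X₂ X₃ X₄ X₅ : 𝓑
    X₁ = (a , g) , 0≤a , 0≤a ⊕ 0≤g
    X₂ = (a , - g) , 0≤a , ≤-trans (proj₁ p∈B) p≤a-g
    X₃ = (p , g) , p∈B
    X₄ = (q , d + g) , q∈B
    X₅ = (r , - g) , r∈B

    closes : Adjacent U X₃ X₄ → Adjacent U X₄ X₅ → Unavoidable U
    closes e₃₄ e₄₅ = pentagon⇒unavoidable e₁₂ e₂₃ e₃₄ e₄₅ e₅₁
      where
      a≤a+g : a ≤ a + g
      a≤a+g = certified 0≤g (solve (a ∷ g ∷ []))
      e₁₂ : Adjacent U X₁ X₂
      e₁₂ = adjacent← g≢-g a∈U (·-onAxis {y = - g} a≤a+g (+-inverseˡ g))
      e₂₃ : Adjacent U X₂ X₃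
      e₂₃ = adjacent← -g≢g a∈U (·-onAxis {y = g} p≤a-g (+-inverseʳ g))
      e₅₁ : Adjacent U X₅ X₁
      e₅₁ = adjacent→ -g≢g a∈U (·-onAxis {y = - g} r≤a+g (+-inverseˡ g))

  floor·c : g ≤ c → (floor (d + g) , d + g) · (c , - g) ≡ (c , d)
  floor·c g≤c = begin
    (floor (d + g) , d + g) · (c , - g)  ≡⟨ ·-rightDominant {y = d + g} floor≤c-g ⟩
    (c , d + g - g)                      ≡⟨ cong (c ,_) (solve (d ∷ g ∷ [])) ⟩
    (c , d)                              ∎
    where
    open ≡-Reasoning
    -d-g≤c-g : - (d + g) ≤ c - g
    -d-g≤c-g = certified 0≤c+d (solve (c ∷ d ∷ g ∷ []))
    floor≤c-g : floor (d + g) ≤ c - g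
    floor≤c-g = ⊔-lub (slack g≤c) -d-g≤c-g

  c∈B : g ≤ c → InB (c , - g)
  c∈B g≤c = 0≤c , slack g≤c

  c≤a+g : c ≤ a + g
  c≤a+g = certified (slack< c<a ⊕ 0≤g ⊕ one) (solve (a ∷ c ∷ g ∷ []))

  caseA : g ≤ c → 0ℤ ≤ e + d + g → Unavoidable U
  caseA g≤c 0≤e+d+g =
    closes (adjacent→ g≢d+g ef∈U p·floor) (adjacent→ d+g≢-g cd∈U (floor·c g≤c))
    where
    0≤p+g : 0ℤ ≤ e + d + g + g
    0≤p+g = nonneg-by 0≤e+f (solve (d ∷ e ∷ g ∷ []))
    p≤a-g : e + d + g ≤ a - g
    p≤a-g = certified (slack< e+f<a ⊕ one) (solve (a ∷ d ∷ e ∷ g ∷ []))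
    open Cycle (0≤e+d+g , 0≤p+g) (floor∈B (d + g)) (c∈B g≤c) p≤a-g c≤a+g
    -d-g≤e : - (d + g) ≤ e
    -d-g≤e = certified 0≤e+d+g (solve (d ∷ e ∷ g ∷ []))
    q+d+g≤p : floor (d + g) + (d + g) ≤ e + d + g
    q+d+g≤p = subst (floor (d + g) + (d + g) ≤_) (sym (+-assoc e d g))
                (+-monoˡ-≤ (d + g) (⊔-lub 0≤e -d-g≤e))
    p·floor : (e + d + g , g) · (floor (d + g) , d + g) ≡ (e , d + g + g)
    p·floor = begin
      (e + d + g , g) · (floor (d + g) , d + g)  ≡⟨ ·-leftDominant {y = g} {z = floor (d + g)} q+d+g≤p ⟩
      (e + d + g - (d + g) , g + (d + g))         ≡⟨ cong₂ _,_ (solve (d ∷ e ∷ g ∷ [])) (solve (d ∷ g ∷ [])) ⟩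
      (e , d + g + g)                             ∎
      where open ≡-Reasoning

  caseB : g ≤ c → e + d + g < 0ℤ → Unavoidable U
  caseB g≤c e+d+g<0 =
    closes (adjacent← g≢d+g ef∈U (·-rightDominant {y = d + g} floor≤e+g))
           (adjacent→ d+g≢-g cd∈U (floor·c g≤c))
    where
    e≤a-g : e ≤ a - g
    e≤a-g = certified (slack< c<a ⊕ 0≤c+d ⊕ slack< e+d+g<0 ⊕ one ⊕ one)
                      (solve (a ∷ c ∷ d ∷ e ∷ g ∷ []))
    open Cycle e∈B (floor∈B (d + g)) (c∈B g≤c) e≤a-g c≤a+g
    -d-g≤e+g : - (d + g) ≤ e + g
    -d-g≤e+g = certified 0≤e+f (solve (d ∷ e ∷ g ∷ []))
    floor≤e+g : floor (d + g) ≤ e + g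
    floor≤e+g = ⊔-lub (0≤e ⊕ 0≤g) -d-g≤e+g

  caseC : c < g → Unavoidable U
  caseC c<g =
    closes (adjacent← g≢d+g ef∈U (·-rightDominant {y = d + g} c≤e+g)) (adjacent← d+g≢-g cd∈U g·c)
    where
    0≤c+d+g : 0ℤ ≤ c + (d + g)
    0≤c+d+g = nonneg-by (0≤c+d ⊕ 0≤g) (solve (c ∷ d ∷ g ∷ []))
    0≤g-g : 0ℤ ≤ g - g
    0≤g-g = nonneg-by (+≤+ z≤n) (sym (+-inverseʳ g))
    e≤a-g : e ≤ a - g
    e≤a-g = certified (slack< e+f<a ⊕ slack< c<g ⊕ 0≤c+d ⊕ one ⊕ one)
                      (solve (a ∷ c ∷ d ∷ e ∷ g ∷ []))
    g≤a+g : g ≤ a + g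
    g≤a+g = certified 0≤a (solve (a ∷ g ∷ []))
    open Cycle e∈B (0≤c , 0≤c+d+g) (0≤g , 0≤g-g) e≤a-g g≤a+g
    c≤e+g : c ≤ e + g
    c≤e+g = certified (slack< c<g ⊕ 0≤e ⊕ one) (solve (c ∷ e ∷ g ∷ []))
    g≤c+d+g : g ≤ c + (d + g)
    g≤c+d+g = certified 0≤c+d (solve (c ∷ d ∷ g ∷ []))
    g·c : (g , - g) · (c , d + g) ≡ (c , d)
    g·c = begin
      (g , - g) · (c , d + g)  ≡⟨ ·-rightDominant {y = - g} g≤c+d+g ⟩
      (c , - g + (d + g))      ≡⟨ cong (c ,_) (solve (d ∷ g ∷ [])) ⟩
      (c , d)                  ∎
      where open ≡-Reasoning

  unavoidable : Unavoidable U
  unavoidable with g ≤? c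
  ... | no g≰c = caseC (≰⇒> g≰c)
  ... | yes g≤c with 0ℤ ≤? e + d + g
  ...   | yes 0≤e+d+g = caseA g≤c 0≤e+d+g
  ...   | no 0≰e+d+g = caseB g≤c (≰⇒> 0≰e+d+g)

cycle-argument : ∀ (U : ℤ × ℤ → Set) {a c d e f g} →
  U (a , 0ℤ) → U (c , d) → U (e , f) → InB (c , d) → InB (e , f) →
  c < a → e + f < a → 0ℤ < g → f ≡ d + g + g → d ≢ 0ℤ → f ≢ 0ℤ → Unavoidable U
cycle-argument U a∈U cd∈U ef∈U (0≤c , 0≤c+d) (0≤e , 0≤e+f) c<a e+f<a 0<g refl d≢0 f≢0 =
  FiveCycle.unavoidable U a∈U cd∈U ef∈U 0≤c 0≤c+d 0≤e 0≤e+f c<a e+f<a 0<g d≢0 f≢0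

⊔-bounded : ∀ {w x y z a : ℤ} → (w ⊔ x) ⊔ (y ⊔ z) < a → (w < a × x < a) × (y < a × z < a)
⊔-bounded {w} {x} {y} {z} bound =
  (below (≤-trans (i≤i⊔j w x) (i≤i⊔j _ _)) , below (≤-trans (i≤j⊔i w x) (i≤i⊔j _ _))) ,
  (below (≤-trans (i≤i⊔j y z) (i≤j⊔i _ _)) , below (≤-trans (i≤j⊔i y z) (i≤j⊔i _ _)))
  where
  below : ∀ {t} → t ≤ (w ⊔ x) ⊔ (y ⊔ z) → t < _
  below t≤max = ≤-<-trans t≤max bound

reverse-difference : ∀ {d f g} → f ≡ d + g + g → d ≡ f + - g + - g
reverse-difference {d} {f} {g} f≡d+2g = begin
  d                        ≡⟨ solve (d ∷ g ∷ []) ⟩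
  (d + g + g) + - g + - g  ≡⟨ cong (λ m → m + - g + - g) (sym f≡d+2g) ⟩
  f + - g + - g            ∎
  where open ≡-Reasoning

first : ∀ {x y z} → Three x y z x
first = inj₁ refl

second : ∀ {x y z} → Three x y z y
second = inj₂ (inj₁ refl)

third : ∀ {x y z} → Three x y z z
third = inj₂ (inj₂ refl)

mainTheorem14 : (a c d e f : ℤ) → + 1 ≤ a → InB (c , d) → InB (e , f)
    → Oddℤ d → Oddℤ f → d ≢ f
    → ((c ⊔ (c + d)) ⊔ (e ⊔ (e + f))) < a
    → Unavoidable (Three (a , + 0) (c , d) (e , f))
mainTheorem14 a c d e f _ c∈B e∈B d-odd f-odd d≢f bound
  with odd-difference d-odd f-odd | ⊔-bounded bound
... | g , f≡d+2g | (c<a , c+d<a) , (e<a , e+f<a) with <-cmp 0ℤ g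
...   | tri< 0<g _ _ =
  cycle-argument (Three (a , + 0) (c , d) (e , f)) first second third c∈B e∈B
    c<a e+f<a 0<g f≡d+2g (odd⇒≢0 d-odd) (odd⇒≢0 f-odd)
-- g = 0 would give f = d.
...   | tri≈ _ refl _ =
  ⊥-elim (d≢f (sym (trans f≡d+2g (trans (+-identityʳ (d + 0ℤ)) (+-identityʳ d)))))
-- g < 0: exchange the roles of (c,d) and (e,f), since d = f + 2(-g) with -g > 0.
...   | tri> _ _ g<0 =
  cycle-argument (Three (a , + 0) (c , d) (e , f)) first third second e∈B c∈B
    e<a c+d<a (neg-mono-< g<0) (reverse-difference f≡d+2g) (odd⇒≢0 f-odd) (odd⇒≢0 d-odd)
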